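{- Let $t\ge 3$ and $m$ be positive integers, let $G$ be a graph, and let $(T,\mathcal{K},A,\mathcal{S},Z,Z_1)$ be an absorbing structure in $G$ with flexibility $m$. Let $W=V(\mathcal{K})\cup A\cup V(\mathcal{S})\cup Z$ be the set of vertices of the structure. Then for every subset $\bar Z\subseteq Z_1$ with $|\bar Z|=m$, the induced subgraph $G[W\setminus \bar Z]$ has a $K_t$-factor.
   Context: A template with flexibility $m$ is a bipartite graph $T$ on $7m$ vertices with parts $X$ and $Z_1\cup Z_2$, where $|X|=3m$, $|Z_1|=|Z_2|=2m$, such that for every $\bar Z\subseteq Z_1$ with $|\bar Z|=m$ the induced graph $T[V(T)\setminus \bar Z]$ has a perfect matching; $Z_1$ is called the flexible set. An absorbing structure $(T,\mathcal{K},A,\mathcal{S},Z,Z_1)$ with flexibility $m$ in a graph $G$ consists of: a template $T=(X,Z_1\cup Z_2,E)$ with flexibility $m$, flexible set $Z_1$ and maximum degree $\Delta(T)\le 40$, with $X=\{x_1,\dots,x_{3m}\}$, $Z_1=\{z_1,\dots,z_{2m}\}$, $Z_2=\{z_{2m+1},\dots,z_{4m}\}$, where $Z:=Z_1\cup Z_2$ is a set of vertices of $G$; a set $\mathcal{K}=\{K^1,\dots,K^{3m}\}$ of vertex-disjoint $(t-1)$-cliques of $G$; a vertex set $A=\{a_{ij}: x_iz_j\in E(T)\}$ of $G$; and a set $\mathcal{S}=\{S_{ij}: x_iz_j\in E(T)\}$ of vertex-disjoint $(t-1)$-cliques of $G$; such that $V(\mathcal{K})$, $V(\mathcal{S})$,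 $A$, $Z$ are pairwise disjoint and, for all $i,j$ with $x_iz_j\in E(T)$: $\{a_{ij}\}\cup K^i$ spans a copy of $K_t$ in $G$, $\{a_{ij}\}\cup S_{ij}$ spans a copy of $K_t$ in $G$, and $\{z_j\}\cup S_{ij}$ spans a copy of $K_t$ in $G$. A $K_t$-factor is a collection of vertex-disjoint copies of $K_t$ covering all vertices. -}

module Defs where

open import Data.Nat using (ℕ; _≤_; _<_; _*_; _∸_)
open import Data.Bool using (Bool; true)
open import Data.Fin using (Fin; toℕ)
open import Data.Fin.Subset using (Subset; _∈_; _∉_; ∣_∣)
open import Data.Vec using (tabulate)
open import Data.Product using (Σ; _×_; ∃; ∃-syntax)
open import Data.Sum using (_⊎_)
open import Relation.Nullary using (¬_)
open import Relation.Binary.PropositionalEquality using (_≡_; _≢_)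

record Graph (n : ℕ) : Set₁ where
  field
    Adj    : Fin n → Fin n → Set
    sym    : ∀ {u v} → Adj u v → Adj v u
    irrefl : ∀ {v} → ¬ Adj v v
open Graph public

-- A copy of K_s given by an indexing c : Fin s → V(G) with pairwise
-- adjacent (hence distinct) vertices.
IsClique : ∀ {n s} → Graph n → (Fin s → Fin n) → Set
IsClique G c = ∀ a b → a ≢ b → Adj G (c a) (c b)

HasKFactor : ∀ {n} → Graph n → ℕ → (Fin n → Set) → Set
HasKFactor {n} G t U =
  Σ ℕ λ k → Σ (Fin k → Fin t → Fin n) λ c →
      (∀ i → IsClique G (c i))
    × (∀ i a → U (c i a))
    × (∀ i a i' a' → c i a ≡ c i' a' → (i ≡ i') × (a ≡ a'))
    × (∀ v → U v → ∃[ i ] ∃[ a ] (c i a ≡ v))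

-- Templates.  X = {x_0..x_{3m-1}} = Fin (3m), Z = Z_1 ∪ Z_2 = Fin (4m),
-- with Z_1 the indices j with toℕ j < 2m and Z_2 the rest.
-- Edges of T are given by a Boolean function E : X → Z → Bool.

InZ₁ : ∀ m → Fin (4 * m) → Set
InZ₁ m j = toℕ j < 2 * m

⊆Z₁ : ∀ m → Subset (4 * m) → Set
⊆Z₁ m Z̄ = ∀ j → j ∈ Z̄ → InZ₁ m j

HasPerfectMatchingWithout : ∀ m → (Fin (3 * m) → Fin (4 * m) → Bool)
                          → Subset (4 * m) → Set
HasPerfectMatchingWithout m E Z̄ =
  Σ (Fin (3 * m) → Fin (4 * m)) λ f →
      (∀ i → E i (f i) ≡ true)
    × (∀ i i' → f i ≡ f i' → i ≡ i')
    × (∀ i → f i ∉ Z̄)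
    × (∀ j → j ∉ Z̄ → ∃[ i ] (f i ≡ j))

IsTemplate : ∀ m → (Fin (3 * m) → Fin (4 * m) → Bool) → Set
IsTemplate m E =
  ∀ (Z̄ : Subset (4 * m)) → ⊆Z₁ m Z̄ → ∣ Z̄ ∣ ≡ m → HasPerfectMatchingWithout m E Z̄

MaxDegree≤ : ∀ m → (Fin (3 * m) → Fin (4 * m) → Bool) → ℕ → Set
MaxDegree≤ m E d =
    (∀ i → ∣ tabulate (E i) ∣ ≤ d)
  × (∀ j → ∣ tabulate (λ i → E i j) ∣ ≤ d)

record AbsorbingStructure {n : ℕ} (G : Graph n) (t m : ℕ) : Set where
  field
    E          : Fin (3 * m) → Fin (4 * m) → Bool
    template   : IsTemplate m E
    maxDeg     : MaxDegree≤ m E 40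
    z          : Fin (4 * m) → Fin n
    z-inj      : ∀ j j' → z j ≡ z j' → j ≡ j'
    K          : Fin (3 * m) → Fin (t ∸ 1) → Fin n
    K-clique   : ∀ i → IsClique G (K i)
    K-disj     : ∀ i b i' b' → K i b ≡ K i' b' → (i ≡ i') × (b ≡ b')
    a          : ∀ i j → E i j ≡ true → Fin n
    a-inj      : ∀ i j e i' j' e' → a i j e ≡ a i' j' e' → (i ≡ i') × (j ≡ j')
    S          : ∀ i j → E i j ≡ true → Fin (t ∸ 1) → Fin n
    S-clique   : ∀ i j e → IsClique G (S i j e)
    S-disj     : ∀ i j e b i' j' e' b' → S i j e b ≡ S i' j' e' b'
                 → (i ≡ i') × (j ≡ j') × (b ≡ b')
    K≢S        : ∀ i b i' j' e' b' → K i b ≢ S i' j' e' b'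
    K≢a        : ∀ i b i' j' e' → K i b ≢ a i' j' e'
    K≢z        : ∀ i b j → K i b ≢ z j
    S≢a        : ∀ i j e b i' j' e' → S i j e b ≢ a i' j' e'
    S≢z        : ∀ i j e b j' → S i j e b ≢ z j'
    a≢z        : ∀ i j e j' → a i j e ≢ z j'
    aK-adj     : ∀ i j e b → Adj G (a i j e) (K i b)
    aS-adj     : ∀ i j e b → Adj G (a i j e) (S i j e b)
    zS-adj     : ∀ i j e b → Adj G (z j) (S i j e b)

  InW : Fin n → Set
  InW v = (∃[ i ] ∃[ b ] (K i b ≡ v))
        ⊎ (∃[ i ] ∃[ j ] ∃[ e ] (a i j e ≡ v))
        ⊎ (∃[ i ] ∃[ j ] ∃[ e ] ∃[ b ] (S i j e b ≡ v))
        ⊎ (∃[ j ] (z j ≡ v))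

  InW∖ : Subset (4 * m) → Fin n → Set
  InW∖ Z̄ v = InW v × ¬ (∃[ j ] (j ∈ Z̄ × z j ≡ v))

-- Fix a perfect matching f of T − Z̄ given by the template property. Each x_i
-- contributes the K_t {a_{i f(i)}} ∪ K^i, and each edge x_i z_j of T contributes
-- S_ij together with z_j if f(i) = j and with a_ij otherwise. Every vertex of
-- W ∖ Z̄ lies in exactly one of these cliques: a_ij is used by x_i or by the
-- edge x_i z_j according to whether the edge is matched, and z_j with j ∉ Z̄ is
-- used exactly once because f is a bijection onto Z ∖ Z̄.
module Submission where

open import Defs hiding (sym)
open import Axiom.UniquenessOfIdentityProofs using (module Decidable⇒UIP)
open import Data.Bool using (Bool; true) renaming (_≟_ to _≟ᵇ_)
open import Data.Empty using (⊥-elim)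
open import Data.Fin using (Fin; zero; suc)
open import Data.Fin.Properties using (+↔⊎; *↔×; _≟_)
open import Data.Fin.Subset using (Subset; _∈_; _∉_; ∣_∣)
open import Data.Nat using (ℕ; zero; suc; _+_; _*_; _≤_; s≤s)
open import Data.Product using (Σ; _×_; _,_; ∃-syntax; map₁; uncurry)
open import Data.Product.Function.Dependent.Propositional using (Σ-↔)
open import Data.Product.Function.NonDependent.Propositional using (_×-↔_)
open import Data.Sum using (_⊎_; inj₁; inj₂)
open import Data.Sum.Function.Propositional using (_⊎-↔_)
open import Data.Unit using (⊤; tt)
open import Function using (_∘_; _↔_; Inverse; Injection; mk↔ₛ′)
open import Function.Construct.Composition using (_↔-∘_)
open import Function.Construct.Identity using (↔-id)
open import Function.Properties.Inverse using (↔⇒↣)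
open import Relation.Binary.PropositionalEquality using (_≡_; _≢_; refl; sym; trans; cong)
open import Relation.Nullary using (¬_; Dec; yes; no)
import Relation.Nullary as Nullary
open import Relation.Unary using (Decidable; Irrelevant)

Finite : Set → Set
Finite A = ∃[ k ] (Fin k ↔ A)

module _ {A B : Set} where

  Finite-↔ : A ↔ B → Finite A → Finite B
  Finite-↔ A↔B (k , e) = k , A↔B ↔-∘ e

  Finite-⊎ : Finite A → Finite B → Finite (A ⊎ B)
  Finite-⊎ (k , e) (l , e′) = k + l , (e ⊎-↔ e′) ↔-∘ +↔⊎

  Finite-× : Finite A → Finite B → Finite (A × B)
  Finite-× (k , e) (l , e′) = k * l , (e ×-↔ e′) ↔-∘ *↔×

Finite-Fin : ∀ k → Finite (Fin k)
Finite-Fin k = k , ↔-id (Fin k)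

Finite-proposition : ∀ {A : Set} → Dec A → Nullary.Irrelevant A → Finite A
Finite-proposition (yes a) irr = 1 , mk↔ₛ′ (λ _ → a) (λ _ → zero) (irr a) (λ { zero → refl })
Finite-proposition (no ¬a) _   = 0 , mk↔ₛ′ (λ ()) (⊥-elim ∘ ¬a) (⊥-elim ∘ ¬a) (λ ())

Σ-Fin-zero↔ : ∀ {P : Fin zero → Set} → Fin 0 ↔ Σ (Fin zero) P
Σ-Fin-zero↔ = mk↔ₛ′ (λ ()) (λ { (() , _) }) (λ { (() , _) }) (λ ())

⊎↔Σ-Fin-suc : ∀ {N} {P : Fin (suc N) → Set} → (P zero ⊎ Σ (Fin N) (P ∘ suc)) ↔ Σ (Fin (suc N)) P
⊎↔Σ-Fin-suc {N} {P} = mk↔ₛ′ to from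
  (λ { (zero , _) → refl ; (suc _ , _) → refl })
  (λ { (inj₁ _) → refl ; (inj₂ _) → refl })
  where
  to : P zero ⊎ Σ (Fin N) (P ∘ suc) → Σ (Fin (suc N)) P
  to (inj₁ p)       = zero , p
  to (inj₂ (i , p)) = suc i , p
  from : Σ (Fin (suc N)) P → P zero ⊎ Σ (Fin N) (P ∘ suc)
  from (zero , p)  = inj₁ p
  from (suc i , p) = inj₂ (i , p)

Finite-Σ-Fin : ∀ N {P : Fin N → Set} → Decidable P → Irrelevant P → Finite (Σ (Fin N) P)
Finite-Σ-Fin zero    P? irr = 0 , Σ-Fin-zero↔
Finite-Σ-Fin (suc N) P? irr =
  Finite-↔ ⊎↔Σ-Fin-suc
    (Finite-⊎ (Finite-proposition (P? zero) irr) (Finite-Σ-Fin N (P? ∘ suc) irr))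

Finite-Σ : ∀ {A : Set} {P : A → Set} → Finite A → Decidable P → Irrelevant P → Finite (Σ A P)
Finite-Σ {P = P} (k , e) P? irr =
  Finite-↔ (Σ-↔ e (↔-id (P _))) (Finite-Σ-Fin k (P? ∘ Inverse.to e) irr)

record IsCliquePartition {n t} (G : Graph n) (U : Fin n → Set) {I : Set}
                         (c : I → Fin t → Fin n) : Set where
  field
    isClique : ∀ x → IsClique G (c x)
    inside   : ∀ x s → U (c x s)
    disjoint : ∀ x s x′ s′ → c x s ≡ c x′ s′ → x ≡ x′ × s ≡ s′
    covers   : ∀ v → U v → ∃[ x ] ∃[ s ] c x s ≡ v

IsCliquePartition⇒HasKFactor : ∀ {n t} {G : Graph n} {U : Fin n → Set} {I : Set}
  {c : I → Fin t → Fin n} → Finite I → IsCliquePartition G U c → HasKFactor G t U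
IsCliquePartition⇒HasKFactor {U = U} {c = c} (k , e) partition =
  k , c ∘ to , isClique ∘ to , inside ∘ to , disjoint′ , covers′
  where
  open Inverse e using (to; from; strictlyInverseˡ)
  open IsCliquePartition partition
  disjoint′ : ∀ ι s ι′ s′ → c (to ι) s ≡ c (to ι′) s′ → ι ≡ ι′ × s ≡ s′
  disjoint′ ι s ι′ s′ = map₁ (Injection.injective (↔⇒↣ e)) ∘ disjoint (to ι) s (to ι′) s′
  covers′ : ∀ v → U v → ∃[ ι ] ∃[ s ] c (to ι) s ≡ v
  covers′ v v∈U with x , s , refl ← covers v v∈U =
    from x , s , cong (λ y → c y s) (strictlyInverseˡ x)

IsClique-∷ : ∀ {n s} (G : Graph n) {c : Fin (suc s) → Fin n}
  → (∀ b → Adj G (c zero) (c (suc b))) → IsClique G (c ∘ suc) → IsClique G c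
IsClique-∷ G adj clique zero    zero     0≢0  = ⊥-elim (0≢0 refl)
IsClique-∷ G adj clique zero    (suc b)  _    = adj b
IsClique-∷ G adj clique (suc b) zero     _    = Graph.sym G (adj b)
IsClique-∷ G adj clique (suc b) (suc b′) b≢b′ = clique b b′ (b≢b′ ∘ cong suc)

Bool-≡-irrelevant : ∀ {b c : Bool} → Nullary.Irrelevant (b ≡ c)
Bool-≡-irrelevant = Decidable⇒UIP.≡-irrelevant _≟ᵇ_

module _ {n s m} {G : Graph n} (𝒜 : AbsorbingStructure G (suc s) m) where
  open AbsorbingStructure 𝒜

  data Position : Set where
    kᵖ : Fin (3 * m) → Fin s → Position
    aᵖ : ∀ i j → E i j ≡ true → Position
    sᵖ : ∀ i j → E i j ≡ true → Fin s → Position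
    zᵖ : Fin (4 * m) → Position

  vertex : Position → Fin n
  vertex (kᵖ i b)     = K i b
  vertex (aᵖ i j e)   = a i j e
  vertex (sᵖ i j e b) = S i j e b
  vertex (zᵖ j)       = z j

  vertex-injective : ∀ {p q} → vertex p ≡ vertex q → p ≡ q
  vertex-injective {kᵖ _ _}     {kᵖ _ _}     eq with refl , refl ← K-disj _ _ _ _ eq = refl
  vertex-injective {kᵖ _ _}     {aᵖ _ _ _}   eq = ⊥-elim (K≢a _ _ _ _ _ eq)
  vertex-injective {kᵖ _ _}     {sᵖ _ _ _ _} eq = ⊥-elim (K≢S _ _ _ _ _ _ eq)
  vertex-injective {kᵖ _ _}     {zᵖ _}       eq = ⊥-elim (K≢z _ _ _ eq)
  vertex-injective {aᵖ _ _ _}   {kᵖ _ _}     eq = ⊥-elim (K≢a _ _ _ _ _ (sym eq))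
  vertex-injective {aᵖ i j e}   {aᵖ _ _ e′}  eq with refl , refl ← a-inj _ _ _ _ _ _ eq =
    cong (aᵖ i j) (Bool-≡-irrelevant e e′)
  vertex-injective {aᵖ _ _ _}   {sᵖ _ _ _ _} eq = ⊥-elim (S≢a _ _ _ _ _ _ _ (sym eq))
  vertex-injective {aᵖ _ _ _}   {zᵖ _}       eq = ⊥-elim (a≢z _ _ _ _ eq)
  vertex-injective {sᵖ _ _ _ _} {kᵖ _ _}     eq = ⊥-elim (K≢S _ _ _ _ _ _ (sym eq))
  vertex-injective {sᵖ _ _ _ _} {aᵖ _ _ _}   eq = ⊥-elim (S≢a _ _ _ _ _ _ _ eq)
  vertex-injective {sᵖ i j e b} {sᵖ _ _ e′ _} eq
    with refl , refl , refl ← S-disj _ _ _ _ _ _ _ _ eq =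
    cong (λ e → sᵖ i j e b) (Bool-≡-irrelevant e e′)
  vertex-injective {sᵖ _ _ _ _} {zᵖ _}       eq = ⊥-elim (S≢z _ _ _ _ _ eq)
  vertex-injective {zᵖ _}       {kᵖ _ _}     eq = ⊥-elim (K≢z _ _ _ (sym eq))
  vertex-injective {zᵖ _}       {aᵖ _ _ _}   eq = ⊥-elim (a≢z _ _ _ _ (sym eq))
  vertex-injective {zᵖ _}       {sᵖ _ _ _ _} eq = ⊥-elim (S≢z _ _ _ _ _ (sym eq))
  vertex-injective {zᵖ _}       {zᵖ _}       eq = cong zᵖ (z-inj _ _ eq)

  vertex∈W : ∀ p → InW (vertex p)
  vertex∈W (kᵖ i b)     = inj₁ (i , b , refl)
  vertex∈W (aᵖ i j e)   = inj₂ (inj₁ (i , j , e , refl))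
  vertex∈W (sᵖ i j e b) = inj₂ (inj₂ (inj₁ (i , j , e , b , refl)))
  vertex∈W (zᵖ j)       = inj₂ (inj₂ (inj₂ (j , refl)))

  W⇒vertex : ∀ {v} → InW v → ∃[ p ] vertex p ≡ v
  W⇒vertex (inj₁ (i , b , eq))                      = kᵖ i b , eq
  W⇒vertex (inj₂ (inj₁ (i , j , e , eq)))           = aᵖ i j e , eq
  W⇒vertex (inj₂ (inj₂ (inj₁ (i , j , e , b , eq)))) = sᵖ i j e b , eq
  W⇒vertex (inj₂ (inj₂ (inj₂ (j , eq))))            = zᵖ j , eq

  Kept : Subset (4 * m) → Position → Set
  Kept Z̄ (zᵖ j) = j ∉ Z̄
  Kept Z̄ _      = ⊤

  Removed : Subset (4 * m) → Fin n → Set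
  Removed Z̄ v = ∃[ j ] (j ∈ Z̄ × z j ≡ v)

  z-kept : ∀ {Z̄ j p} → zᵖ j ≡ p → Kept Z̄ p → j ∉ Z̄
  z-kept refl j∉Z̄ = j∉Z̄

  kept⇒W∖ : ∀ {Z̄ p} → Kept Z̄ p → InW∖ Z̄ (vertex p)
  kept⇒W∖ {p = p} kept = vertex∈W p , λ (j , j∈Z̄ , eq) → z-kept (vertex-injective eq) kept j∈Z̄

  ¬Removed⇒kept : ∀ {Z̄} p → ¬ Removed Z̄ (vertex p) → Kept Z̄ p
  ¬Removed⇒kept (kᵖ _ _)     _ = tt
  ¬Removed⇒kept (aᵖ _ _ _)   _ = tt
  ¬Removed⇒kept (sᵖ _ _ _ _) _ = tt
  ¬Removed⇒kept (zᵖ j)       ¬removed j∈Z̄ = ¬removed (j , j∈Z̄ , refl)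

  W∖⇒kept : ∀ {Z̄ v} → InW∖ Z̄ v → ∃[ p ] Kept Z̄ p × vertex p ≡ v
  W∖⇒kept (v∈W , ¬removed) with p , refl ← W⇒vertex v∈W = p , ¬Removed⇒kept p ¬removed , refl

  Edge : Set
  Edge = Σ (Fin (3 * m) × Fin (4 * m)) (uncurry λ i j → E i j ≡ true)

  edge-≡ : ∀ {i j i′ j′ e e′} → i ≡ i′ → j ≡ j′ → _≡_ {A = Edge} ((i , j) , e) ((i′ , j′) , e′)
  edge-≡ {e = e} {e′} refl refl = cong (_ ,_) (Bool-≡-irrelevant e e′)

  Finite-Index : Finite (Fin (3 * m) ⊎ Edge)
  Finite-Index = Finite-⊎ (Finite-Fin _)
    (Finite-Σ (Finite-× (Finite-Fin _) (Finite-Fin _)) (λ (i , j) → E i j ≟ᵇ true) Bool-≡-irrelevant)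

  module _ {Z̄ : Subset (4 * m)} {f : Fin (3 * m) → Fin (4 * m)}
           (f-edge : ∀ i → E i (f i) ≡ true) (f-injective : ∀ i i′ → f i ≡ f i′ → i ≡ i′)
           (f∉Z̄ : ∀ i → f i ∉ Z̄) (f-onto : ∀ j → j ∉ Z̄ → ∃[ i ] f i ≡ j) where

    apex : ∀ i j → E i j ≡ true → Dec (f i ≡ j) → Position
    apex i j e (yes _) = zᵖ j
    apex i j e (no _)  = aᵖ i j e

    cliqueAt : Fin (3 * m) ⊎ Edge → Fin (suc s) → Position
    cliqueAt (inj₁ i)             zero    = aᵖ i (f i) (f-edge i)
    cliqueAt (inj₁ i)             (suc b) = kᵖ i b
    cliqueAt (inj₂ ((i , j) , e)) zero    = apex i j e (f i ≟ j)
    cliqueAt (inj₂ ((i , j) , e)) (suc b) = sᵖ i j e b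

    apex-matched : ∀ {i j e} d → f i ≡ j → apex i j e d ≡ zᵖ j
    apex-matched (yes _)  _  = refl
    apex-matched (no f≢)  f≡ = ⊥-elim (f≢ f≡)

    apex-unmatched : ∀ {i j e} d → f i ≢ j → apex i j e d ≡ aᵖ i j e
    apex-unmatched (yes f≡) f≢ = ⊥-elim (f≢ f≡)
    apex-unmatched (no _)   _  = refl

    apex-adj : ∀ i j e d b → Adj G (vertex (apex i j e d)) (S i j e b)
    apex-adj i j e (yes _) = zS-adj i j e
    apex-adj i j e (no _)  = aS-adj i j e

    apex-kept : ∀ i j e d → Kept Z̄ (apex i j e d)
    apex-kept i _ _ (yes refl) = f∉Z̄ i
    apex-kept _ _ _ (no _)     = tt

    apex≢kᵖ : ∀ {i j e i′ b} d → apex i j e d ≢ kᵖ i′ b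
    apex≢kᵖ (yes _) ()
    apex≢kᵖ (no _)  ()

    apex≢sᵖ : ∀ {i j e i′ j′ e′ b} d → apex i j e d ≢ sᵖ i′ j′ e′ b
    apex≢sᵖ (yes _) ()
    apex≢sᵖ (no _)  ()

    apex≢matched : ∀ {i j e i′} d → apex i j e d ≢ aᵖ i′ (f i′) (f-edge i′)
    apex≢matched (yes _)  ()
    apex≢matched (no f≢) refl = f≢ refl

    apex-injective : ∀ {i j e i′ j′ e′} d d′ → apex i j e d ≡ apex i′ j′ e′ d′
                   → _≡_ {A = Edge} ((i , j) , e) ((i′ , j′) , e′)
    apex-injective (yes f≡) (yes f≡′) refl = edge-≡ (f-injective _ _ (trans f≡ (sym f≡′))) refl
    apex-injective (no _)   (no _)    refl = refl
    apex-injective (yes _)  (no _)    ()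
    apex-injective (no _)   (yes _)   ()

    cliqueAt-isClique : ∀ x → IsClique G (vertex ∘ cliqueAt x)
    cliqueAt-isClique (inj₁ i)             = IsClique-∷ G (aK-adj i (f i) (f-edge i)) (K-clique i)
    cliqueAt-isClique (inj₂ ((i , j) , e)) = IsClique-∷ G (apex-adj i j e (f i ≟ j)) (S-clique i j e)

    cliqueAt-kept : ∀ x s → Kept Z̄ (cliqueAt x s)
    cliqueAt-kept (inj₁ _)             zero    = tt
    cliqueAt-kept (inj₁ _)             (suc _) = tt
    cliqueAt-kept (inj₂ ((i , j) , e)) zero    = apex-kept i j e (f i ≟ j)
    cliqueAt-kept (inj₂ _)             (suc _) = tt

    cliqueAt-injective : ∀ x s x′ s′ → cliqueAt x s ≡ cliqueAt x′ s′ → x ≡ x′ × s ≡ s′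
    cliqueAt-injective (inj₁ _) zero    (inj₁ _) zero     refl = refl , refl
    cliqueAt-injective (inj₁ _) zero    (inj₁ _) (suc _)  ()
    cliqueAt-injective (inj₁ _) (suc _) (inj₁ _) zero     ()
    cliqueAt-injective (inj₁ _) (suc _) (inj₁ _) (suc _)  refl = refl , refl
    cliqueAt-injective (inj₁ _) zero    (inj₂ _) zero     eq = ⊥-elim (apex≢matched _ (sym eq))
    cliqueAt-injective (inj₁ _) zero    (inj₂ _) (suc _)  ()
    cliqueAt-injective (inj₁ _) (suc _) (inj₂ _) zero     eq = ⊥-elim (apex≢kᵖ _ (sym eq))
    cliqueAt-injective (inj₁ _) (suc _) (inj₂ _) (suc _)  ()
    cliqueAt-injective (inj₂ _) zero    (inj₁ _) zero     eq = ⊥-elim (apex≢matched _ eq)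
    cliqueAt-injective (inj₂ _) zero    (inj₁ _) (suc _)  eq = ⊥-elim (apex≢kᵖ _ eq)
    cliqueAt-injective (inj₂ _) (suc _) (inj₁ _) zero     ()
    cliqueAt-injective (inj₂ _) (suc _) (inj₁ _) (suc _)  ()
    cliqueAt-injective (inj₂ _) zero    (inj₂ _) zero     eq = cong inj₂ (apex-injective _ _ eq) , refl
    cliqueAt-injective (inj₂ _) zero    (inj₂ _) (suc _)  eq = ⊥-elim (apex≢sᵖ _ eq)
    cliqueAt-injective (inj₂ _) (suc _) (inj₂ _) zero     eq = ⊥-elim (apex≢sᵖ _ (sym eq))
    cliqueAt-injective (inj₂ _) (suc _) (inj₂ _) (suc _)  refl = refl , refl

    cliqueAt-covers : ∀ p → Kept Z̄ p → ∃[ x ] ∃[ s ] cliqueAt x s ≡ p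
    cliqueAt-covers (kᵖ i b)     _ = inj₁ i , suc b , refl
    cliqueAt-covers (aᵖ i j e)   _ with f i ≟ j
    ... | yes refl = inj₁ i , zero , cong (aᵖ i (f i)) (Bool-≡-irrelevant _ _)
    ... | no f≢    = inj₂ ((i , j) , e) , zero , apex-unmatched (f i ≟ j) f≢
    cliqueAt-covers (sᵖ i j e b) _ = inj₂ ((i , j) , e) , suc b , refl
    cliqueAt-covers (zᵖ j)       j∉Z̄ with i , refl ← f-onto j j∉Z̄ =
      inj₂ ((i , f i) , f-edge i) , zero , apex-matched (f i ≟ f i) refl

    absorbingPartition : IsCliquePartition G (InW∖ Z̄) (λ x → vertex ∘ cliqueAt x)
    absorbingPartition = record
      { isClique = cliqueAt-isClique
      ; inside   = λ x s → kept⇒W∖ (cliqueAt-kept x s)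
      ; disjoint = λ x s x′ s′ → cliqueAt-injective x s x′ s′ ∘ vertex-injective
      ; covers   = covers
      }
      where
      covers : ∀ v → InW∖ Z̄ v → ∃[ x ] ∃[ s ] vertex (cliqueAt x s) ≡ v
      covers v v∈W∖Z̄ with p , kept , refl ← W∖⇒kept v∈W∖Z̄
                     with x , s , refl ← cliqueAt-covers p kept = x , s , refl

fact2p6 : ∀ {n : ℕ} (G : Graph n) (t m : ℕ) → 3 ≤ t → 1 ≤ m
          → (𝒜 : AbsorbingStructure G t m)
          → (Z̄ : Subset (4 * m)) → ⊆Z₁ m Z̄ → ∣ Z̄ ∣ ≡ m
          → HasKFactor G t (AbsorbingStructure.InW∖ 𝒜 Z̄)
fact2p6 G (suc (suc (suc _))) m (s≤s (s≤s (s≤s _))) _ 𝒜 Z̄ Z̄⊆Z₁ ∣Z̄∣≡m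
  with f , f-edge , f-injective , f∉Z̄ , f-onto ← AbsorbingStructure.template 𝒜 Z̄ Z̄⊆Z₁ ∣Z̄∣≡m =
  IsCliquePartition⇒HasKFactor (Finite-Index 𝒜)
                               (absorbingPartition 𝒜 f-edge f-injective f∉Z̄ f-onto)
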